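{- Let $G_1=(\{0,\dots,n-1\},E_1)$ and $G_2=(\{0,\dots,n-1\},E_2)$ be simple graphs without vertices of degree $0$, and let $k=2n+4$. If $A$ is an automorphism of the cube $k^2$ such that $s^{G_1}(v)=s^{G_2}(A(v))$ for all $v\in[k]^2$, then $A=F_\pi$ for some $F_\pi\in\mathbb{F}_k$, and moreover $\pi(i)\le n-1$ if and only if $i\le n-1$.
   Context: Let $[k]=\{0,\dots,k-1\}$. For a simple graph $G=(\{0,\dots,n-1\},E)$ and $k=2n+4$, the coloring $s^G:[k]^2\to\{0,1\}$ is defined by $s^G([i,j])=1$ if $[i,j]=[n,n]$, or $[i,j]=[n,n+1]$, or ($i,j\le n-1$ and $\{i,j\}\in E$); otherwise $s^G([i,j])=0$. A set of $k$ distinct points of $[k]^2$ is a line if it can be ordered $(q^1,\dots,q^k)$ such that in each coordinate the sequence of values is strictly increasing, strictly decreasing or constant, with at least one coordinate non-constant. An automorphism of the cube $k^2$ is a permutation of $[k]^2$ mapping every line onto a line. $\mathbb{F}_k$ is the group of maps $F_\pi([x_1,x_2])=[\pi(x_1),\pi(x_2)]$ for permutations $\pi$ of $[k]$ with $\pi(k-p-1)=k-\pi(p)-1$ for all $p$. -}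

module Defs where

open import Data.Nat using (ℕ; suc; _+_; _*_; _<_; _<?_; _≡ᵇ_)
open import Data.Fin using (Fin; toℕ; fromℕ<; opposite)
open import Data.Bool using (Bool; true; false; _∧_; _∨_)
open import Data.Product using (Σ; ∃; ∃-syntax; _×_; _,_; proj₁; proj₂)
open import Data.Sum using (_⊎_)
open import Relation.Nullary using (¬_; yes; no)
open import Relation.Binary.PropositionalEquality using (_≡_)
open import Function using (_⇔_; Injective)
open import Function.Bundles using (_↔_; Inverse)
open import Data.Fin.Permutation using (Permutation′; _⟨$⟩ʳ_)

record SimpleGraph (n : ℕ) : Set where
  field
    adj    : Fin n → Fin n → Bool
    sym    : ∀ i j → adj i j ≡ adj j i
    irrefl : ∀ i → adj i i ≡ false
open SimpleGraph public

NoIsolated : {n : ℕ} → SimpleGraph n → Set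
NoIsolated {n} G = ∀ (i : Fin n) → ∃[ j ] (adj G i j ≡ true)

kOf : ℕ → ℕ
kOf n = 2 * n + 4

Point : ℕ → Set
Point k = Fin k × Fin k

sG : {n : ℕ} → SimpleGraph n → Point (kOf n) → Bool
sG {n} G (i , j) with toℕ i <? n | toℕ j <? n
... | yes p | yes q = adj G (fromℕ< p) (fromℕ< q)
... | _     | _     = (toℕ i ≡ᵇ n) ∧ ((toℕ j ≡ᵇ n) ∨ (toℕ j ≡ᵇ suc n))

StrictInc : {k : ℕ} → (Fin k → Fin k) → Set
StrictInc {k} f = ∀ (a b : Fin k) → toℕ a < toℕ b → toℕ (f a) < toℕ (f b)

StrictDec : {k : ℕ} → (Fin k → Fin k) → Set
StrictDec {k} f = ∀ (a b : Fin k) → toℕ a < toℕ b → toℕ (f b) < toℕ (f a)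

Const : {k : ℕ} → (Fin k → Fin k) → Set
Const {k} f = ∀ (a b : Fin k) → f a ≡ f b

CoordOK : {k : ℕ} → (Fin k → Fin k) → Set
CoordOK f = StrictInc f ⊎ StrictDec f ⊎ Const f

IsLine : {k : ℕ} → (Point k → Set) → Set
IsLine {k} S =
  ∃[ q ] ( Injective _≡_ _≡_ q
         × (∀ (p : Point k) → S p ⇔ (∃[ t ] (q t ≡ p)))
         × CoordOK (λ t → proj₁ (q t))
         × CoordOK (λ t → proj₂ (q t))
         × ¬ (Const (λ t → proj₁ (q t)) × Const (λ t → proj₂ (q t))) )

Image : {k : ℕ} → (Point k → Point k) → (Point k → Set) → Point k → Set
Image A S p = ∃[ v ] (S v × A v ≡ p)

IsCubeAutomorphism : {k : ℕ} → (Point k ↔ Point k) → Set₁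
IsCubeAutomorphism {k} A =
  ∀ (S : Point k → Set) → IsLine S → IsLine (Image (Inverse.to A) S)

Fπ : {k : ℕ} → Permutation′ k → Point k → Point k
Fπ π (x₁ , x₂) = (π ⟨$⟩ʳ x₁ , π ⟨$⟩ʳ x₂)

Symmetric : {k : ℕ} → Permutation′ k → Set
Symmetric {k} π = ∀ (p : Fin k) → π ⟨$⟩ʳ opposite p ≡ opposite (π ⟨$⟩ʳ p)

-- A strictly monotone self-map of [k] is the identity or the reversal, so the lines of k² are
-- exactly the k rows, the k columns and the two diagonals.  An automorphism A permutes these
-- lines; three pairwise disjoint rows must go to three pairwise disjoint lines, and a diagonal
-- meets every line but the other diagonal, so rows and columns go to rows and columns.  Since a
-- row and a column always meet while distinct parallel lines never do, A either maps rows to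
-- rows and columns to columns, i.e. A(x, y) = (α x, β y), or swaps the two families.  The
-- colouring pins A down: (n, n) is the only coloured point on a diagonal, so A fixes it and
-- preserves each diagonal, which forces β = α and α(k-1-x) = k-1-α(x); the coloured point
-- (n, n+1) rules out the swap.  Finally every i < n is the first coordinate of an edge point
-- (i, j), whose image (α i, α j) is coloured; since α n = n, it cannot be a marker (n, _), so
-- α i < n, and the same argument for α⁻¹ gives the converse.

module Submission where

open import Defs hiding (sym)
open import Data.Nat using (ℕ; zero; suc; _+_; _*_; _≤_; _<_; z≤n; s≤s; _<?_; _≡ᵇ_)
open import Data.Nat.Properties hiding (_≟_)
open import Data.Nat.Tactic.RingSolver using (solve-∀)
open import Data.Fin using (Fin; toℕ; fromℕ<; opposite; _≟_)
open import Data.Fin.Properties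
  using (toℕ-injective; toℕ<n; toℕ-fromℕ<; fromℕ<-injective; opposite-prop; opposite-involutive)
open import Data.Bool using (true; _∧_; _∨_)
open import Data.Bool.Properties using (T-≡; T-∧; T-∨)
open import Data.Product using (Σ; ∃; ∃₂; ∃-syntax; _×_; _,_; proj₁; proj₂; uncurry)
open import Data.Product.Properties using (,-injectiveˡ; ,-injectiveʳ)
open import Data.Sum using (_⊎_; inj₁; inj₂; [_,_]′)
import Data.Sum as Sum
open import Data.Empty using (⊥; ⊥-elim)
open import Relation.Nullary using (¬_; yes; no)
open import Relation.Binary.PropositionalEquality
open import Function using (_∘_; _⇔_; Injective; Equivalence; mk⇔)
open import Function.Bundles using (_↔_; Inverse; Injection; mk↔ₛ′)
open import Function.Construct.Composition using (_⇔-∘_)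
open import Function.Properties.Inverse using (↔⇒↣)
open import Data.Fin.Permutation using (Permutation′; _⟨$⟩ʳ_)

open ≡-Reasoning

-- Strictly monotone self-maps of Fin k

opposite-reverses-< : ∀ {k} {a b : Fin k} → toℕ a < toℕ b → toℕ (opposite b) < toℕ (opposite a)
opposite-reverses-< {a = a} {b} a<b rewrite opposite-prop a | opposite-prop b =
  ∸-monoʳ-< (s≤s a<b) (toℕ<n b)

strictInc-inflationary : ∀ {k} {f : Fin k → Fin k} → StrictInc f → ∀ t → toℕ t ≤ toℕ (f t)
strictInc-inflationary {k} {f} inc t = go (toℕ t) t refl
  where
  go : ∀ m (t : Fin k) → toℕ t ≡ m → m ≤ toℕ (f t)
  go zero    _ _  = z≤n
  go (suc m) t t≡ = ≤-<-trans (go m s (toℕ-fromℕ< m<k)) (inc s t s<t)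
    where
    m<k : m < k
    m<k = <-trans (n<1+n m) (subst (_< k) t≡ (toℕ<n t))
    s : Fin k
    s = fromℕ< m<k
    s<t : toℕ s < toℕ t
    s<t = subst₂ _<_ (sym (toℕ-fromℕ< m<k)) (sym t≡) (n<1+n m)

-- The upper bound f t ≤ t is the lower bound for the conjugate of f by opposite.
strictInc⇒id : ∀ {k} {f : Fin k → Fin k} → StrictInc f → ∀ t → f t ≡ t
strictInc⇒id {f = f} inc t = toℕ-injective (≤-antisym ft≤t (strictInc-inflationary inc t))
  where
  conjugate-inc : StrictInc (opposite ∘ f ∘ opposite)
  conjugate-inc a b a<b = opposite-reverses-< (inc _ _ (opposite-reverses-< a<b))
  opposite-bound : toℕ (opposite t) ≤ toℕ (opposite (f t))
  opposite-bound = subst (λ s → toℕ (opposite t) ≤ toℕ (opposite (f s))) (opposite-involutive t)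
                         (strictInc-inflationary conjugate-inc (opposite t))
  ft≤t : toℕ (f t) ≤ toℕ t
  ft≤t = ≮⇒≥ λ t<ft → <⇒≱ (opposite-reverses-< t<ft) opposite-bound

strictDec⇒opposite : ∀ {k} {f : Fin k → Fin k} → StrictDec f → ∀ t → f t ≡ opposite t
strictDec⇒opposite {f = f} dec t = begin
  f t                       ≡⟨ opposite-involutive (f t) ⟨
  opposite (opposite (f t)) ≡⟨ cong opposite (strictInc⇒id opposite-inc t) ⟩
  opposite t                ∎
  where
  opposite-inc : StrictInc (opposite ∘ f)
  opposite-inc a b a<b = opposite-reverses-< (dec a b a<b)

data Direction : Set where
  ascending descending : Direction

orient : ∀ {k} → Direction → Fin k → Fin k
orient ascending  t = t
orient descending t = opposite t

orient-involutive : ∀ {k} d (t : Fin k) → orient d (orient d t) ≡ t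
orient-involutive ascending  t = refl
orient-involutive descending t = opposite-involutive t

relative : Direction → Direction → Direction
relative ascending  d          = d
relative descending ascending  = descending
relative descending descending = ascending

orient-relative : ∀ {k} d₁ d₂ (t : Fin k) → orient d₂ (orient d₁ t) ≡ orient (relative d₁ d₂) t
orient-relative ascending  d₂         t = refl
orient-relative descending ascending  t = refl
orient-relative descending descending t = opposite-involutive t

orient-coordOK : ∀ {k} d → CoordOK (orient {k} d)
orient-coordOK ascending  = inj₁ λ _ _ a<b → a<b
orient-coordOK descending = inj₂ (inj₁ λ _ _ → opposite-reverses-<)

data CoordShape {k} (f : Fin k → Fin k) : Set where
  moving : ∀ d → (∀ t → f t ≡ orient d t) → CoordShape f
  fixed  : ∀ a → (∀ t → f t ≡ a) → CoordShape f

coordShape : ∀ {k} {f : Fin k → Fin k} → Fin k → CoordOK f → CoordShape f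
coordShape t₀ (inj₁ inc)        = moving ascending (strictInc⇒id inc)
coordShape t₀ (inj₂ (inj₁ dec)) = moving descending (strictDec⇒opposite dec)
coordShape t₀ (inj₂ (inj₂ c))   = fixed _ λ t → c t t₀

-- The lines of k²

data Axis : Set where
  first second : Axis

other : Axis → Axis
other first  = second
other second = first

distinct-axes-cover : ∀ {e₁ e₂ : Axis} → e₁ ≢ e₂ → ∀ e → e₁ ≡ e ⊎ e₂ ≡ e
distinct-axes-cover {first}  {first}  ne _      = ⊥-elim (ne refl)
distinct-axes-cover {second} {second} ne _      = ⊥-elim (ne refl)
distinct-axes-cover {first}  {second} _  first  = inj₁ refl
distinct-axes-cover {first}  {second} _  second = inj₂ refl
distinct-axes-cover {second} {first}  _  first  = inj₂ refl
distinct-axes-cover {second} {first}  _  second = inj₁ refl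

coord : ∀ {k} → Axis → Point k → Fin k
coord first  = proj₁
coord second = proj₂

data Line (k : ℕ) : Set where
  axial    : Axis → Fin k → Line k
  diagonal : Direction → Line k

infix 4 _∈_
_∈_ : ∀ {k} → Point k → Line k → Set
p ∈ axial e a  = coord e p ≡ a
p ∈ diagonal d = proj₂ p ≡ orient d (proj₁ p)

Traces : ∀ {k} → (Fin k → Point k) → Line k → Set
Traces q ℓ = ∀ p → (∃[ t ] q t ≡ p) ⇔ p ∈ ℓ

trace-classification : ∀ {k} (q : Fin k → Point k) →
  CoordShape (proj₁ ∘ q) → CoordShape (proj₂ ∘ q) → ¬ (Const (proj₁ ∘ q) × Const (proj₂ ∘ q)) →
  ∃ (Traces q)
trace-classification q (moving d₁ e₁) (moving d₂ e₂) _ = diagonal (relative d₁ d₂) , λ p → mk⇔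
  (λ { (t , refl) → begin
    proj₂ (q t)                            ≡⟨ e₂ t ⟩
    orient d₂ t                            ≡⟨ cong (orient d₂) (orient-involutive d₁ t) ⟨
    orient d₂ (orient d₁ (orient d₁ t))    ≡⟨ orient-relative d₁ d₂ _ ⟩
    orient (relative d₁ d₂) (orient d₁ t)  ≡⟨ cong (orient (relative d₁ d₂)) (e₁ t) ⟨
    orient (relative d₁ d₂) (proj₁ (q t))  ∎ })
  (λ p∈ → orient d₁ (proj₁ p) , cong₂ _,_ (trans (e₁ _) (orient-involutive d₁ _))
                                          (trans (e₂ _) (trans (orient-relative d₁ d₂ _) (sym p∈))))
trace-classification q (moving d e₁) (fixed a e₂) _ = axial second a , λ p → mk⇔
  (λ { (t , refl) → e₂ t })
  (λ p∈ → orient d (proj₁ p) , cong₂ _,_ (trans (e₁ _) (orient-involutive d _)) (trans (e₂ _) (sym p∈)))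
trace-classification q (fixed a e₁) (moving d e₂) _ = axial first a , λ p → mk⇔
  (λ { (t , refl) → e₁ t })
  (λ p∈ → orient d (proj₂ p) , cong₂ _,_ (trans (e₁ _) (sym p∈)) (trans (e₂ _) (orient-involutive d _)))
trace-classification q (fixed a e₁) (fixed b e₂) nonconstant =
  ⊥-elim (nonconstant ((λ s t → trans (e₁ s) (sym (e₁ t))) , λ s t → trans (e₂ s) (sym (e₂ t))))

isLine⇒standard : ∀ {k} {S : Point k → Set} → Fin k → IsLine S → Σ (Line k) λ ℓ → ∀ p → S p ⇔ p ∈ ℓ
isLine⇒standard t₀ (q , _ , S⇔ , ok₁ , ok₂ , nonconstant) =
  let ℓ , traces = trace-classification q (coordShape t₀ ok₁) (coordShape t₀ ok₂) nonconstant
  in ℓ , λ p → traces p ⇔-∘ S⇔ p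

standard-isLine : ∀ {k} {t₀ t₁ : Fin k} → t₀ ≢ t₁ → (ℓ : Line k) → IsLine (_∈ ℓ)
standard-isLine t₀≢t₁ (axial first a) =
  (a ,_) , ,-injectiveʳ , (λ p → mk⇔ (λ p∈ → proj₂ p , cong (_, proj₂ p) (sym p∈)) λ { (t , refl) → refl }) ,
  inj₂ (inj₂ λ _ _ → refl) , orient-coordOK ascending , λ (_ , c) → t₀≢t₁ (c _ _)
standard-isLine t₀≢t₁ (axial second a) =
  (_, a) , ,-injectiveˡ , (λ p → mk⇔ (λ p∈ → proj₁ p , cong (proj₁ p ,_) (sym p∈)) λ { (t , refl) → refl }) ,
  orient-coordOK ascending , inj₂ (inj₂ λ _ _ → refl) , λ (c , _) → t₀≢t₁ (c _ _)
standard-isLine t₀≢t₁ (diagonal d) =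
  (λ t → t , orient d t) , ,-injectiveˡ ,
  (λ p → mk⇔ (λ p∈ → proj₁ p , cong (proj₁ p ,_) (sym p∈)) λ { (t , refl) → refl }) ,
  orient-coordOK ascending , orient-coordOK d , λ (c , _) → t₀≢t₁ (c _ _)

record Meet {k} (ℓ ℓ' : Line k) : Set where
  constructor meet
  field
    point : Point k
    ∈ˡ    : point ∈ ℓ
    ∈ʳ    : point ∈ ℓ'

parallel-meet⇒≡ : ∀ {k e} {a b : Fin k} → Meet (axial e a) (axial e b) → a ≡ b
parallel-meet⇒≡ (meet _ p∈ p∈') = trans (sym p∈) p∈'

at : ∀ {k} → Axis → Fin k → Fin k → Point k
at first  a b = a , b
at second a b = b , a

at-∈ : ∀ {k} e (a b : Fin k) → at e a b ∈ axial e a × at e a b ∈ axial (other e) b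
at-∈ first  _ _ = refl , refl
at-∈ second _ _ = refl , refl

crossing-meet : ∀ {k} e (a b : Fin k) → Meet (axial e a) (axial (other e) b)
crossing-meet e a b = uncurry (meet (at e a b)) (at-∈ e a b)

diagonal-meets-axial : ∀ {k} d e (a : Fin k) → Meet (diagonal d) (axial e a)
diagonal-meets-axial d first  a = meet (a , orient d a) refl refl
diagonal-meets-axial d second a = meet (orient d a , a) (sym (orient-involutive d a)) refl

diagonal-meets-itself : ∀ {k} → Fin k → ∀ d → Meet (diagonal d) (diagonal d)
diagonal-meets-itself t₀ d = meet (t₀ , orient d t₀) refl refl

diagonal-meet : ∀ {k} → Fin k → ∀ d (ℓ : Line k) → Meet (diagonal d) ℓ ⊎ ℓ ≡ diagonal (relative descending d)
diagonal-meet _  d          (axial e a)             = inj₁ (diagonal-meets-axial d e a)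
diagonal-meet t₀ ascending  (diagonal ascending)  = inj₁ (diagonal-meets-itself t₀ ascending)
diagonal-meet t₀ descending (diagonal descending) = inj₁ (diagonal-meets-itself t₀ descending)
diagonal-meet _  ascending  (diagonal descending) = inj₂ refl
diagonal-meet _  descending (diagonal ascending)  = inj₂ refl

pairwise-disjoint⇒axial : ∀ {k} → Fin k → {ℓ ℓ' ℓ'' : Line k} →
  ¬ Meet ℓ ℓ' → ¬ Meet ℓ ℓ'' → ¬ Meet ℓ' ℓ'' → ∃₂ λ e a → ℓ ≡ axial e a
pairwise-disjoint⇒axial _  {axial e a} _ _ _ = e , a , refl
pairwise-disjoint⇒axial t₀ {diagonal d} {ℓ'} {ℓ''} ¬m' ¬m'' ¬m'''
  with diagonal-meet t₀ d ℓ' | diagonal-meet t₀ d ℓ''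
... | inj₁ m    | _         = ⊥-elim (¬m' m)
... | inj₂ _    | inj₁ m    = ⊥-elim (¬m'' m)
... | inj₂ refl | inj₂ refl = ⊥-elim (¬m''' (diagonal-meets-itself t₀ (relative descending d)))

-- Automorphisms of k² for k ≥ 3

module LineImages {k} {z₀ z₁ z₂ : Fin k} (z₀≢z₁ : z₀ ≢ z₁) (z₀≢z₂ : z₀ ≢ z₂) (z₁≢z₂ : z₁ ≢ z₂)
                  (A : Point k ↔ Point k) (automorphism : IsCubeAutomorphism A) where

  f : Point k → Point k
  f = Inverse.to A

  f-injective : Injective _≡_ _≡_ f
  f-injective = Injection.injective (↔⇒↣ A)

  private
    image-standard : ∀ ℓ → Σ (Line k) λ ℓ' → ∀ p → Image f (_∈ ℓ) p ⇔ p ∈ ℓ'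
    image-standard ℓ = isLine⇒standard z₀ (automorphism (_∈ ℓ) (standard-isLine z₀≢z₁ ℓ))

  -- Opaque, so that unification never unfolds the classification of the image line.
  opaque
    img : Line k → Line k
    img ℓ = proj₁ (image-standard ℓ)

    img-image : ∀ ℓ p → Image f (_∈ ℓ) p ⇔ p ∈ img ℓ
    img-image ℓ = proj₂ (image-standard ℓ)

  ∈-img : ∀ {ℓ p} → p ∈ ℓ → f p ∈ img ℓ
  ∈-img {ℓ} {p} p∈ = Equivalence.to (img-image ℓ (f p)) (p , p∈ , refl)

  ∈-img⁻¹ : ∀ {ℓ v} → f v ∈ img ℓ → v ∈ ℓ
  ∈-img⁻¹ {ℓ} {v} fv∈ =
    let w , w∈ , fw≡fv = Equivalence.from (img-image ℓ (f v)) fv∈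
    in subst (_∈ ℓ) (f-injective fw≡fv) w∈

  meet-image : ∀ {ℓ ℓ'} → Meet ℓ ℓ' → Meet (img ℓ) (img ℓ')
  meet-image (meet p p∈ p∈') = meet (f p) (∈-img p∈) (∈-img p∈')

  meet-preimage : ∀ {ℓ ℓ'} → Meet (img ℓ) (img ℓ') → Meet ℓ ℓ'
  meet-preimage {ℓ} {ℓ'} (meet p p∈ p∈') with Equivalence.from (img-image ℓ p) p∈
  ... | w , w∈ , refl = meet w w∈ (∈-img⁻¹ p∈')

  images-≢ : ∀ {ℓ ℓ' p} → p ∈ ℓ' → ¬ p ∈ ℓ → img ℓ ≢ img ℓ'
  images-≢ {p = p} p∈ p∉ eq = p∉ (∈-img⁻¹ (subst (f p ∈_) (sym eq) (∈-img p∈)))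

  others : ∀ a → ∃₂ λ b c → a ≢ b × a ≢ c × b ≢ c
  others a with a ≟ z₀ | a ≟ z₁
  ... | yes refl | _        = z₁ , z₂ , z₀≢z₁ , z₀≢z₂ , z₁≢z₂
  ... | no _     | yes refl = z₀ , z₂ , ≢-sym z₀≢z₁ , z₁≢z₂ , z₀≢z₂
  ... | no a≢z₀  | no a≢z₁  = z₀ , z₁ , a≢z₀ , a≢z₁ , z₀≢z₁

  axial-image-axial : ∀ e a → ∃₂ λ e' b → img (axial e a) ≡ axial e' b
  axial-image-axial e a =
    let b , c , a≢b , a≢c , b≢c = others a
    in pairwise-disjoint⇒axial z₀ (disjoint a≢b) (disjoint a≢c) (disjoint b≢c)
    where
    disjoint : ∀ {a b} → a ≢ b → ¬ Meet (img (axial e a)) (img (axial e b))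
    disjoint {a} {b} a≢b m = a≢b (parallel-meet⇒≡ (meet-preimage {axial e a} {axial e b} m))

  parallel-images-coincide : ∀ {ℓ ℓ' e a b} → img ℓ ≡ axial e a → img ℓ' ≡ axial e b →
                             Meet ℓ ℓ' → img ℓ ≡ img ℓ'
  parallel-images-coincide {ℓ} {ℓ'} {e} ≡a ≡b m =
    trans ≡a (trans (cong (axial e) (parallel-meet⇒≡ (subst₂ Meet ≡a ≡b (meet-image {ℓ} {ℓ'} m)))) (sym ≡b))

  crossing-images-not-parallel : ∀ {e a c e' e'' b b'} →
    img (axial e a) ≡ axial e' b → img (axial (other e) c) ≡ axial e'' b' → e' ≢ e''
  crossing-images-not-parallel {e} {a} {c} ≡b ≡b' refl =
    let a' , _ , a≢a' , _ = others a
        p∈a' , p∈c = at-∈ e a' c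
    in images-≢ p∈c (λ p∈a → a≢a' (trans (sym p∈a) p∈a'))
                (parallel-images-coincide ≡b ≡b' (crossing-meet e a c))

  -- Lines of axis e are mapped to lines of axis σ e, the line axial e a to axial (σ e) (τ e a).
  σ : Axis → Axis
  σ e = proj₁ (axial-image-axial e z₀)

  private
    σ-image : ∀ e → img (axial e z₀) ≡ axial (σ e) _
    σ-image e = proj₂ (proj₂ (axial-image-axial e z₀))

  σ-other : ∀ e → σ e ≢ σ (other e)
  σ-other e = crossing-images-not-parallel (σ-image e) (σ-image (other e))

  axis-image : ∀ e a → ∃[ b ] img (axial e a) ≡ axial (σ e) b
  axis-image e a =
    let e' , b , ≡b = axial-image-axial e a
        e'≢σo = crossing-images-not-parallel ≡b (σ-image (other e))
    in b , [ (λ σe≡e' → subst (λ x → img (axial e a) ≡ axial x b) (sym σe≡e') ≡b)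
           , (λ σo≡e' → ⊥-elim (e'≢σo (sym σo≡e'))) ]′
           (distinct-axes-cover (σ-other e) e')

  τ : Axis → Fin k → Fin k
  τ e a = proj₁ (axis-image e a)

  coord-image : ∀ e {e'} → σ e ≡ e' → ∀ p → coord e' (f p) ≡ τ e (coord e p)
  coord-image e σe≡e' p =
    subst (λ x → f p ∈ axial x (τ e (coord e p))) σe≡e'
          (subst (f p ∈_) (proj₂ (axis-image e (coord e p))) (∈-img {axial e (coord e p)} refl))

  product-or-swap : (∀ x y → f (x , y) ≡ (τ first x , τ second y))
                  ⊎ (∀ x y → f (x , y) ≡ (τ second y , τ first x))
  product-or-swap = by-cases (σ first) (σ second) refl refl
    where
    by-cases : ∀ e₁ e₂ → σ first ≡ e₁ → σ second ≡ e₂ →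
               (∀ x y → f (x , y) ≡ (τ first x , τ second y)) ⊎ (∀ x y → f (x , y) ≡ (τ second y , τ first x))
    by-cases first  second σ₁ σ₂ = inj₁ λ x y → cong₂ _,_ (coord-image first σ₁ (x , y)) (coord-image second σ₂ (x , y))
    by-cases second first  σ₁ σ₂ = inj₂ λ x y → cong₂ _,_ (coord-image second σ₂ (x , y)) (coord-image first σ₁ (x , y))
    by-cases first  first  σ₁ σ₂ = ⊥-elim (σ-other first (trans σ₁ (sym σ₂)))
    by-cases second second σ₁ σ₂ = ⊥-elim (σ-other first (trans σ₁ (sym σ₂)))

  -- Otherwise the images of two parallel lines meeting the diagonal would both coincide with its image.
  diagonal-image-not-axial : ∀ {d e' a} → img (diagonal d) ≢ axial e' a
  diagonal-image-not-axial {d} {e'} ≡a =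
    [ clash first , clash second ]′ (distinct-axes-cover (σ-other first) e')
    where
    clash : ∀ e → σ e ≡ e' → ⊥
    clash e σe≡e' = images-≢ p∈z₁ (λ p∈z₀ → z₀≢z₁ (trans (sym p∈z₀) p∈z₁))
                             (trans (sym (meets z₀)) (meets z₁))
      where
      p∈z₁ : at e z₁ z₀ ∈ axial e z₁
      p∈z₁ = proj₁ (at-∈ e z₁ z₀)
      meets : ∀ x → img (diagonal d) ≡ img (axial e x)
      meets x = parallel-images-coincide {diagonal d} {axial e x} ≡a
        (subst (λ y → img (axial e x) ≡ axial y (τ e x)) σe≡e' (proj₂ (axis-image e x)))
        (diagonal-meets-axial d e x)

  diagonal-image : ∀ d → ∃[ d' ] img (diagonal d) ≡ diagonal d'
  diagonal-image d = by-cases (img (diagonal d)) refl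
    where
    by-cases : ∀ ℓ → img (diagonal d) ≡ ℓ → ∃[ d' ] img (diagonal d) ≡ diagonal d'
    by-cases (diagonal d') ≡ℓ = d' , ≡ℓ
    by-cases (axial e' a)  ≡ℓ = ⊥-elim (diagonal-image-not-axial ≡ℓ)

-- The colouring s^G

kOf-≡ : ∀ n → 2 * n + 4 ≡ 3 + (n + suc n)
kOf-≡ = solve-∀

<kOf : ∀ {m} n → m ≤ suc (suc n) → m < kOf n
<kOf {m} n m≤ = subst (m <_) (sym (kOf-≡ n)) (s≤s (≤-trans m≤ (+-monoʳ-≤ 2 (m≤m+n n (suc n)))))

n<kOf : ∀ n → n < kOf n
n<kOf n = <kOf n (m≤n+m n 2)

centre centre⁺ : ∀ n → Fin (kOf n)
centre  n = fromℕ< (n<kOf n)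
centre⁺ n = fromℕ< (<kOf n (m≤n+m (suc n) 1))

toℕ≡n⇒centre : ∀ {n} {i : Fin (kOf n)} → toℕ i ≡ n → i ≡ centre n
toℕ≡n⇒centre i≡n = toℕ-injective (trans i≡n (sym (toℕ-fromℕ< _)))

centre⁺≢centre : ∀ n → centre⁺ n ≢ centre n
centre⁺≢centre n eq = 1+n≢n (fromℕ<-injective _ _ _ _ eq)

lift : ∀ {n} → Fin n → Fin (kOf n)
lift {n} u = fromℕ< (<-trans (toℕ<n u) (n<kOf n))

lift<n : ∀ {n} (u : Fin n) → toℕ (lift u) < n
lift<n u = subst (_< _) (sym (toℕ-fromℕ< _)) (toℕ<n u)

fromℕ<-lift : ∀ {n} (u : Fin n) → fromℕ< (lift<n u) ≡ u
fromℕ<-lift u = toℕ-injective (trans (toℕ-fromℕ< _) (toℕ-fromℕ< _))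

data Coloured {n} (G : SimpleGraph n) : Point (kOf n) → Set where
  edge   : ∀ {i j} (i<n : toℕ i < n) (j<n : toℕ j < n) →
           adj G (fromℕ< i<n) (fromℕ< j<n) ≡ true → Coloured G (i , j)
  marker : ∀ {i j} → toℕ i ≡ n → toℕ j ≡ n ⊎ toℕ j ≡ suc n → Coloured G (i , j)

marker-test : ∀ x y n → ((x ≡ᵇ n) ∧ ((y ≡ᵇ n) ∨ (y ≡ᵇ suc n))) ≡ true ⇔ (x ≡ n × (y ≡ n ⊎ y ≡ suc n))
marker-test x y n = mk⇔
  (λ t → let tx , ty = Equivalence.to T-∧ (Equivalence.from T-≡ t)
         in ≡ᵇ⇒≡ x n tx , Sum.map (≡ᵇ⇒≡ y n) (≡ᵇ⇒≡ y (suc n)) (Equivalence.to T-∨ ty))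
  (λ (x≡ , y≡) → Equivalence.to T-≡ (Equivalence.from T-∧
    (≡⇒≡ᵇ x n x≡ , Equivalence.from T-∨ (Sum.map (≡⇒≡ᵇ y n) (≡⇒≡ᵇ y (suc n)) y≡))))

marker⇔Coloured : ∀ {n} (G : SimpleGraph n) {i j : Fin (kOf n)} → ¬ (toℕ i < n × toℕ j < n) →
  ((toℕ i ≡ᵇ n) ∧ ((toℕ j ≡ᵇ n) ∨ (toℕ j ≡ᵇ suc n))) ≡ true ⇔ Coloured G (i , j)
marker⇔Coloured G outside = mk⇔ (uncurry marker ∘ Equivalence.to (marker-test _ _ _)) λ where
  (edge i<n j<n _) → ⊥-elim (outside (i<n , j<n))
  (marker i≡ j≡)   → Equivalence.from (marker-test _ _ _) (i≡ , j≡)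

sG≡true⇔Coloured : ∀ {n} (G : SimpleGraph n) p → sG G p ≡ true ⇔ Coloured G p
sG≡true⇔Coloured {n} G (i , j) with toℕ i <? n | toℕ j <? n
... | yes i<n | yes j<n = mk⇔ (edge i<n j<n) λ where
      (edge _ _ e)   → e
      (marker i≡n _) → ⊥-elim (<-irrefl i≡n i<n)
... | yes _   | no j≮n = marker⇔Coloured G (j≮n ∘ proj₂)
... | no i≮n  | _      = marker⇔Coloured G (i≮n ∘ proj₁)

centre-marked : ∀ {n} {G : SimpleGraph n} → Coloured G (centre n , centre n)
centre-marked = marker (toℕ-fromℕ< _) (inj₁ (toℕ-fromℕ< _))

centre⁺-marked : ∀ {n} {G : SimpleGraph n} → Coloured G (centre n , centre⁺ n)
centre⁺-marked = marker (toℕ-fromℕ< _) (inj₂ (toℕ-fromℕ< _))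

coloured-bounded : ∀ {n} {G : SimpleGraph n} {i j} → Coloured G (i , j) → toℕ i ≤ n × toℕ j ≤ suc n
coloured-bounded (edge i<n j<n _) = <⇒≤ i<n , m≤n⇒m≤1+n (<⇒≤ j<n)
coloured-bounded (marker i≡n j≡)  =
  ≤-reflexive i≡n , [ m≤n⇒m≤1+n ∘ ≤-reflexive , ≤-reflexive ]′ j≡

opposite-sum : ∀ {k} (i : Fin k) → suc (toℕ i + toℕ (opposite i)) ≡ k
opposite-sum i = trans (cong (suc (toℕ i) +_) (opposite-prop i)) (m+[n∸m]≡n (toℕ<n i))

-- Coloured points have coordinate sum at most 2n + 1, while the anti-diagonal has sum 2n + 3.
coloured∉antidiagonal : ∀ {n} {G : SimpleGraph n} {p} → Coloured G p → ¬ p ∈ diagonal descending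
coloured∉antidiagonal {n} {p = i , _} c refl =
  let i≤ , j≤ = coloured-bounded c
  in <-irrefl (trans (opposite-sum i) (kOf-≡ n)) (m≤n⇒m≤1+n (s≤s (s≤s (+-mono-≤ i≤ j≤))))

coloured-on-diagonal : ∀ {n} {G : SimpleGraph n} {p} d → Coloured G p → p ∈ diagonal d →
                       p ≡ (centre n , centre n)
coloured-on-diagonal descending c p∈ = ⊥-elim (coloured∉antidiagonal c p∈)
coloured-on-diagonal {G = G} ascending (edge i<n _ e) refl with trans (sym e) (irrefl G (fromℕ< i<n))
... | ()
coloured-on-diagonal ascending (marker i≡n _) refl = cong₂ _,_ (toℕ≡n⇒centre i≡n) (toℕ≡n⇒centre i≡n)

block-preserved : ∀ {n} {G G' : SimpleGraph n} (β : Fin (kOf n) → Fin (kOf n)) → NoIsolated G →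
  (∀ i → β i ≡ centre n → i ≡ centre n) → (∀ x y → Coloured G (x , y) → Coloured G' (β x , β y)) →
  ∀ i → toℕ i < n → toℕ (β i) < n
block-preserved {n} {G} {G'} β noIsolated centre-reflected maps i i<n with noIsolated (fromℕ< i<n)
... | w , adj≡true = below (maps i (lift w) (edge i<n (lift<n w) adj-lift))
  where
  adj-lift : adj G (fromℕ< i<n) (fromℕ< (lift<n w)) ≡ true
  adj-lift = subst (λ v → adj G _ v ≡ true) (sym (fromℕ<-lift w)) adj≡true
  below : Coloured G' (β i , β (lift w)) → toℕ (β i) < n
  below (edge βi<n _ _) = βi<n
  below (marker βi≡n _) =
    ⊥-elim (<-irrefl (trans (cong toℕ (centre-reflected i (toℕ≡n⇒centre βi≡n))) (toℕ-fromℕ< _)) i<n)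

-- Colour-preserving automorphisms

module ColourPreserving (n : ℕ) (G₁ G₂ : SimpleGraph n) (A : Point (kOf n) ↔ Point (kOf n))
  (automorphism : IsCubeAutomorphism A) (preserves : ∀ v → sG G₁ v ≡ sG G₂ (Inverse.to A v)) where

  private
    k : ℕ
    k = kOf n
    N N⁺ : Fin k
    N  = centre n
    N⁺ = centre⁺ n
    small : ∀ m → m ≤ 2 → Fin k
    small m m≤2 = fromℕ< (<kOf n (≤-trans m≤2 (m≤m+n 2 n)))

  open LineImages {z₀ = small 0 z≤n} {small 1 (s≤s z≤n)} {small 2 (s≤s (s≤s z≤n))}
                  ((λ ()) ∘ fromℕ<-injective 0 1 _ _) ((λ ()) ∘ fromℕ<-injective 0 2 _ _)
                  ((λ ()) ∘ fromℕ<-injective 1 2 _ _) A automorphism public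

  coloured-image⇔ : ∀ {v} → Coloured G₁ v ⇔ Coloured G₂ (f v)
  coloured-image⇔ {v} = mk⇔
    (λ c → Equivalence.to (sG≡true⇔Coloured G₂ (f v)) (trans (sym (preserves v)) (Equivalence.from (sG≡true⇔Coloured G₁ v) c)))
    (λ c → Equivalence.to (sG≡true⇔Coloured G₁ v) (trans (preserves v) (Equivalence.from (sG≡true⇔Coloured G₂ (f v)) c)))

  centre-coloured : Coloured G₂ (f (N , N))
  centre-coloured = Equivalence.to coloured-image⇔ centre-marked

  centre∈img : f (N , N) ∈ img (diagonal ascending)
  centre∈img = ∈-img {diagonal ascending} {N , N} refl

  diagonal-fixed : img (diagonal ascending) ≡ diagonal ascending
  diagonal-fixed = by-cases (diagonal-image ascending)
    where
    by-cases : ∃[ d ] img (diagonal ascending) ≡ diagonal d → img (diagonal ascending) ≡ diagonal ascending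
    by-cases (ascending  , ≡d) = ≡d
    by-cases (descending , ≡d) = ⊥-elim (coloured∉antidiagonal centre-coloured (subst (f (N , N) ∈_) ≡d centre∈img))

  centre-fixed : f (N , N) ≡ (N , N)
  centre-fixed = coloured-on-diagonal ascending centre-coloured (subst (f (N , N) ∈_) diagonal-fixed centre∈img)

  antidiagonal-fixed : img (diagonal descending) ≡ diagonal descending
  antidiagonal-fixed = by-cases (diagonal-image descending)
    where
    opposite-N∉ : ¬ (N , opposite N) ∈ diagonal ascending
    opposite-N∉ e = coloured∉antidiagonal (centre-marked {G = G₁}) (sym e)
    by-cases : ∃[ d ] img (diagonal descending) ≡ diagonal d → img (diagonal descending) ≡ diagonal descending
    by-cases (descending , ≡d) = ≡d
    by-cases (ascending  , ≡d) = ⊥-elim (images-≢ {diagonal ascending} {diagonal descending} {N , opposite N}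
                                                   refl opposite-N∉ (trans diagonal-fixed (sym ≡d)))

  -- Under a swap A (n , n+1) is a coloured point with second coordinate n, which can only be
  -- (n , n) = A (n , n).
  not-swapped : ∀ {α β : Fin k → Fin k} → ¬ (∀ x y → f (x , y) ≡ (β y , α x))
  not-swapped {α} {β} swapped =
    clash (subst (Coloured G₂) (swapped N N⁺) (Equivalence.to coloured-image⇔ centre⁺-marked))
    where
    αN≡N : α N ≡ N
    αN≡N = cong proj₂ (trans (sym (swapped N N)) centre-fixed)
    clash : Coloured G₂ (β N⁺ , α N) → ⊥
    clash (edge _ αN<n _)  = <-irrefl (trans (cong toℕ αN≡N) (toℕ-fromℕ< _)) αN<n
    clash (marker βN⁺≡n _) = centre⁺≢centre n (,-injectiveʳ (f-injective (begin
      f (N , N⁺)  ≡⟨ swapped N N⁺ ⟩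
      (β N⁺ , α N) ≡⟨ cong₂ _,_ (toℕ≡n⇒centre βN⁺≡n) αN≡N ⟩
      (N , N)      ≡⟨ centre-fixed ⟨
      f (N , N)    ∎)))

  module Product {α β : Fin k → Fin k} (product : ∀ x y → f (x , y) ≡ (α x , β y)) where

    β≗α : ∀ x → β x ≡ α x
    β≗α x = subst (_∈ diagonal ascending) (product x x)
                  (subst (f (x , x) ∈_) diagonal-fixed (∈-img refl))

    f≗α×α : ∀ x y → f (x , y) ≡ (α x , α y)
    f≗α×α x y = trans (product x y) (cong (α x ,_) (β≗α y))

    α-opposite : ∀ x → α (opposite x) ≡ opposite (α x)
    α-opposite x = trans (sym (β≗α (opposite x)))
      (subst (_∈ diagonal descending) (product x (opposite x))
             (subst (f (x , opposite x) ∈_) antidiagonal-fixed (∈-img refl)))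

    α-injective : ∀ {x y} → α x ≡ α y → x ≡ y
    α-injective {x} {y} αx≡αy = ,-injectiveˡ (f-injective (begin
      f (x , x)   ≡⟨ f≗α×α x x ⟩
      (α x , α x) ≡⟨ cong (_, α x) αx≡αy ⟩
      (α y , α x) ≡⟨ f≗α×α y x ⟨
      f (y , x)   ∎))

    α⁻¹ : Fin k → Fin k
    α⁻¹ a = proj₁ (Inverse.from A (a , a))

    α∘α⁻¹ : ∀ a → α (α⁻¹ a) ≡ a
    α∘α⁻¹ a = ,-injectiveˡ (trans (sym (product _ _)) (Inverse.strictlyInverseˡ A (a , a)))

    α⁻¹∘α : ∀ x → α⁻¹ (α x) ≡ x
    α⁻¹∘α x = α-injective (α∘α⁻¹ (α x))

    π : Permutation′ k
    π = mk↔ₛ′ α α⁻¹ α∘α⁻¹ α⁻¹∘α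

    π-symmetric : Symmetric π
    π-symmetric = α-opposite

    f≗Fπ : ∀ v → f v ≡ Fπ π v
    f≗Fπ (x , y) = f≗α×α x y

    α-centre : α N ≡ N
    α-centre = ,-injectiveˡ (trans (sym (f≗α×α N N)) centre-fixed)

    π-preserves-block : NoIsolated G₁ → NoIsolated G₂ → ∀ i → (toℕ (π ⟨$⟩ʳ i) < n) ⇔ (toℕ i < n)
    π-preserves-block noIsolated₁ noIsolated₂ i = mk⇔
      (λ αi<n → subst (λ j → toℕ j < n) (α⁻¹∘α i)
                      (block-preserved α⁻¹ noIsolated₂ α⁻¹-reflects backward (α i) αi<n))
      (block-preserved α noIsolated₁ α-reflects forward i)
      where
      α-reflects : ∀ i → α i ≡ N → i ≡ N
      α-reflects i αi≡N = α-injective (trans αi≡N (sym α-centre))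
      α⁻¹-reflects : ∀ i → α⁻¹ i ≡ N → i ≡ N
      α⁻¹-reflects i α⁻¹i≡N = trans (sym (α∘α⁻¹ i)) (trans (cong α α⁻¹i≡N) α-centre)
      forward : ∀ x y → Coloured G₁ (x , y) → Coloured G₂ (α x , α y)
      forward x y c = subst (Coloured G₂) (f≗α×α x y) (Equivalence.to coloured-image⇔ c)
      backward : ∀ x y → Coloured G₂ (x , y) → Coloured G₁ (α⁻¹ x , α⁻¹ y)
      backward x y c = Equivalence.from coloured-image⇔
        (subst (Coloured G₂) (sym (trans (f≗α×α _ _) (cong₂ _,_ (α∘α⁻¹ x) (α∘α⁻¹ y)))) c)

lemma11 : (n : ℕ) (G₁ G₂ : SimpleGraph n) → NoIsolated G₁ → NoIsolated G₂ →
    (A : Point (kOf n) ↔ Point (kOf n)) → IsCubeAutomorphism A →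
    (∀ (v : Point (kOf n)) → sG G₁ v ≡ sG G₂ (Inverse.to A v)) →
    ∃[ π ] ( Symmetric {kOf n} π
           × (∀ (v : Point (kOf n)) → Inverse.to A v ≡ Fπ π v)
           × (∀ (i : Fin (kOf n)) → (toℕ (π ⟨$⟩ʳ i) < n) ⇔ (toℕ i < n)) )
lemma11 n G₁ G₂ noIsolated₁ noIsolated₂ A automorphism preserves =
  [ (λ product → let open Product product
                 in π , π-symmetric , f≗Fπ , π-preserves-block noIsolated₁ noIsolated₂)
  , ⊥-elim ∘ not-swapped ]′ product-or-swap
  where open ColourPreserving n G₁ G₂ A automorphism preserves
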